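{- Let $G$ be a connected graph with strong tree width at most $k$ in which every geodesic cycle has length at most $c$. Then there exists a strong tree decomposition of $G$ of width at most $k$ with the following property: if $S$ is a nonempty proper subset of a bag $B$, then there is a vertex $v\in B\setminus S$ at distance at most $c$ from $S$.
   Context: A geodesic cycle in $G$ is a cycle $C$ such that for any two vertices of $C$ their distance along $C$ equals their distance in $G$. A strong tree decomposition of $G$ is $(\{X_i\}_{i\in I},T)$ with $\{X_i\}$ a partition of $V(G)$ and $T$ a tree such that each edge has both ends in one bag or in bags of adjacent tree nodes; its width is the maximum bag size, and the strong tree width is the minimum width. The distance from a vertex $v$ to a set $S$ is the minimum distance from $v$ to a vertex of $S$. -}

module Defs where

open import Data.Nat using (ℕ; zero; suc; _≤_; _∸_; _⊓_; ∣_-_∣)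
open import Data.Fin using (Fin; toℕ; inject₁; fromℕ; _≟_)
import Data.Fin as F
open import Data.List using (length; filter; allFin)
open import Data.Product using (Σ; ∃; _×_; _,_)
open import Relation.Binary.PropositionalEquality using (_≡_; _≢_)
open import Relation.Nullary using (¬_; Dec)
open import Function.Definitions using (Injective)
open import Data.Sum using (_⊎_)
open import Data.Fin.Subset using (Subset; _∈_; _∉_)

record Graph : Set₁ where
  field
    size   : ℕ
    Adj    : Fin size → Fin size → Set
    adj?   : ∀ u v → Dec (Adj u v)
    sym    : ∀ {u v} → Adj u v → Adj v u
    irrefl : ∀ {u} → ¬ Adj u u

open Graph public

V : Graph → Set
V G = Fin (size G)

data Walk (G : Graph) : V G → V G → ℕ → Set where
  nil  : ∀ {u} → Walk G u u zero
  cons : ∀ {u w v ℓ} → Adj G u w → Walk G w v ℓ → Walk G u v (suc ℓ)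

IsDist : (G : Graph) → V G → V G → ℕ → Set
IsDist G u v d = Walk G u v d × (∀ m → Walk G u v m → d ≤ m)

DistAtMost : (G : Graph) → V G → V G → ℕ → Set
DistAtMost G u v c = ∃ λ d → IsDist G u v d × d ≤ c

Connected : Graph → Set
Connected G = V G × (∀ u v → ∃ λ ℓ → Walk G u v ℓ)

-- A cycle of length L = suc L' ≥ 3: vertices f 0, …, f L' pairwise distinct,
-- consecutive ones adjacent, and f L' adjacent to f 0.
record Cycle (G : Graph) : Set where
  field
    L'    : ℕ
    three : 2 ≤ L'
    f     : Fin (suc L') → V G
    inj   : Injective _≡_ _≡_ f
    step  : ∀ (i : Fin L') → Adj G (f (inject₁ i)) (f (F.suc i))
    close : Adj G (f (fromℕ L')) (f F.zero)

open Cycle public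

cycleLength : ∀ {G} → Cycle G → ℕ
cycleLength C = suc (L' C)

cycDist : ∀ {G} (C : Cycle G) → Fin (suc (L' C)) → Fin (suc (L' C)) → ℕ
cycDist C i j = ∣ toℕ i - toℕ j ∣ ⊓ (cycleLength C ∸ ∣ toℕ i - toℕ j ∣)

Geodesic : ∀ {G} → Cycle G → Set
Geodesic {G} C = ∀ i j → IsDist G (f C i) (f C j) (cycDist C i j)

IsTree : Graph → Set
IsTree T = Connected T × ¬ Cycle T

-- Strong tree decomposition of G: a tree T and a map β assigning each vertex
-- of G to a node of T (so the bags X_t = β⁻¹(t) partition V(G)); every bag is
-- nonempty (parts of a partition); every edge has both ends in one bag or in
-- bags of adjacent tree nodes.
record StrongTreeDecomp (G : Graph) : Set₁ where
  field
    T      : Graph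
    tree   : IsTree T
    β      : V G → V T
    nonempty : ∀ (t : V T) → ∃ λ v → β v ≡ t
    edges  : ∀ {u v} → Adj G u v → (β u ≡ β v) ⊎ Adj T (β u) (β v)
  bagSize : V T → ℕ
  bagSize t = length (filter (λ v → β v ≟ t) (allFin (size G)))

open StrongTreeDecomp public

WidthAtMost : ∀ {G} → StrongTreeDecomp G → ℕ → Set
WidthAtMost D k = ∀ t → bagSize D t ≤ k

StwAtMost : Graph → ℕ → Set₁
StwAtMost G k = Σ (StrongTreeDecomp G) λ D → WidthAtMost D k

GeodesicCyclesAtMost : Graph → ℕ → Set
GeodesicCyclesAtMost G c = ∀ (C : Cycle G) → Geodesic C → cycleLength C ≤ c

Property : ∀ {G} → StrongTreeDecomp G → ℕ → Set
Property {G} D c =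
  ∀ (t : V (T D)) (S : Subset (size G)) →
    (∀ v → v ∈ S → β D v ≡ t) →
    (∃ λ s → s ∈ S) →
    (∃ λ w → β D w ≡ t × w ∉ S) →
    ∃ λ v → β D v ≡ t × v ∉ S × (∃ λ s → s ∈ S × DistAtMost G v s c)

-- Refine the given decomposition: split every bag into the classes of the equivalence relation
-- generated by "same bag and distance at most c", and join two classes when an edge of G does.
-- Bags only shrink, and a nonempty proper subset S of a class is left by a generating pair, which
-- yields a vertex outside S within distance c of S.  It is
-- acyclic: a cycle through an edge {p₀, p₁} lifts to a closed walk of G crossing between the classes
-- p₀ and p₁ an odd number of times, yet every closed walk crosses an even number of times.  For the
-- latter, split closed walks at repeated vertices and non-geodesic cycles along shortcuts until only
-- closed walks of length at most c remain; on those, vertices sharing a bag share a class, so the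
-- crossings are the crossings of a closed walk in the original tree, which are even.

module Submission where

open import Defs hiding (sym)
import Algebra.Properties.CommutativeSemigroup
open import Algebra.Bundles using (CommutativeRing; CommutativeMonoid)
open import Data.Bool using (Bool; true; false; _xor_)
open import Data.Bool.Properties using (¬-not; xor-∧-commutativeRing; xor-assoc; xor-comm; xor-same; xor-identityʳ)
open import Data.Empty using (⊥-elim)
open import Data.Fin as F using (Fin; toℕ; inject₁; fromℕ)
import Data.Fin.Properties as FinP
open import Data.Fin.Subset.Properties using (_∈?_)
open import Data.List using (List; []; _∷_; filter; allFin; length; lookup)
open import Data.List.Membership.Propositional using () renaming (_∈_ to _∈ₗ_)
open import Data.List.Membership.Propositional.Properties using (∈-allFin; ∈-filter⁺; ∈-filter⁻; ∈-lookup)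
open import Data.List.Relation.Binary.Sublist.Propositional using (⊆-refl)
open import Data.List.Relation.Binary.Sublist.Propositional.Properties using (filter⁺; length-mono-≤)
import Data.List.Relation.Unary.All as All
import Data.List.Relation.Unary.Any as Any
open import Data.List.Relation.Unary.Any.Properties using (lookup-index)
open import Data.List.Relation.Unary.AllPairs using (_∷_)
open import Data.List.Relation.Unary.Unique.Propositional using (Unique)
open import Data.List.Relation.Unary.Unique.Propositional.Properties using (allFin⁺)
import Data.List.Relation.Unary.Unique.Propositional.Properties as Unique
open import Data.Nat using (ℕ; zero; suc; _+_; _∸_; _≤_; _<_; z≤n; s≤s; _⊓_; ∣_-_∣)
open import Data.Nat.Induction using (<-rec)
open import Data.Nat.Properties
open import Data.Product using (Σ; ∃; ∃₂; _×_; _,_; proj₁; proj₂)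
open import Data.Sum using (_⊎_; inj₁; inj₂)
open import Function using (_∘_; case_of_)
open import Function.Bundles using (mk⇔)
open import Relation.Binary.Definitions using (tri<; tri≈; tri>)
open import Relation.Binary.PropositionalEquality
open import Relation.Binary.Structures using (IsDecEquivalence)
open import Relation.Nullary using (Dec; yes; no; does; ¬_; ¬?; _×-dec_; _⊎-dec_; map′)
open import Relation.Nullary.Decidable using (dec-true; dec-false; does-⇔)

module ⊕ = Algebra.Properties.CommutativeSemigroup
  (CommutativeMonoid.commutativeSemigroup (CommutativeRing.+-commutativeMonoid xor-∧-commutativeRing))
module +ℕ = Algebra.Properties.CommutativeSemigroup +-commutativeSemigroup

length-filter-mono : ∀ {A : Set} {P Q : A → Set} (P? : ∀ x → Dec (P x)) (Q? : ∀ x → Dec (Q x)) →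
  (∀ x → P x → Q x) → ∀ xs → length (filter P? xs) ≤ length (filter Q? xs)
length-filter-mono P? Q? P⇒Q xs = length-mono-≤ (filter⁺ P? Q? (λ { refl → P⇒Q _ }) (⊆-refl {x = xs}))

lookup-injective : ∀ {A : Set} {xs : List A} → Unique xs → ∀ i j → lookup xs i ≡ lookup xs j → i ≡ j
lookup-injective (_ ∷ _) F.zero F.zero _ = refl
lookup-injective (x∉ ∷ _) F.zero (F.suc j) eq = ⊥-elim (All.lookup x∉ (∈-lookup j) eq)
lookup-injective (x∉ ∷ _) (F.suc i) F.zero eq = ⊥-elim (All.lookup x∉ (∈-lookup i) (sym eq))
lookup-injective (_ ∷ u) (F.suc i) (F.suc j) eq = cong F.suc (lookup-injective u i j eq)

injective⊎collision : ∀ {n} {A : Set} (_≟_ : ∀ (x y : A) → Dec (x ≡ y)) (f : Fin n → A) →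
  (∀ i j → f i ≡ f j → i ≡ j) ⊎ ∃₂ λ i j → i F.< j × f i ≡ f j
injective⊎collision _≟_ f with FinP.any? (λ i → FinP.any? (λ j → (i FinP.<? j) ×-dec (f i ≟ f j)))
... | yes (i , j , i<j , same) = inj₂ (i , j , i<j , same)
... | no none = inj₁ injective
  where
    injective : ∀ i j → f i ≡ f j → i ≡ j
    injective i j same with FinP.<-cmp i j
    ... | tri< i<j _ _ = ⊥-elim (none (i , j , i<j , same))
    ... | tri≈ _ i≡j _ = i≡j
    ... | tri> _ _ j<i = ⊥-elim (none (j , i , j<i , sym same))

module Pair {n : ℕ} (a b : Fin n) where

  IsPair : Fin n → Fin n → Set
  IsPair p q = (p ≡ a × q ≡ b) ⊎ (p ≡ b × q ≡ a)

  isPair? : ∀ p q → Dec (IsPair p q)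
  isPair? p q = ((p FinP.≟ a) ×-dec (q FinP.≟ b)) ⊎-dec ((p FinP.≟ b) ×-dec (q FinP.≟ a))

  pair : Fin n → Fin n → Bool
  pair p q = does (isPair? p q)

  pair-true : ∀ {p q} → IsPair p q → pair p q ≡ true
  pair-true = dec-true (isPair? _ _)

  pair-true⁻¹ : ∀ {p q} → pair p q ≡ true → IsPair p q
  pair-true⁻¹ = true⇒witness (isPair? _ _)
    where
      true⇒witness : ∀ {A : Set} (a? : Dec A) → does a? ≡ true → A
      true⇒witness (yes a) _ = a

  IsPair-swap : ∀ {p q} → IsPair p q → IsPair q p
  IsPair-swap (inj₁ (p≡a , q≡b)) = inj₂ (q≡b , p≡a)
  IsPair-swap (inj₂ (p≡b , q≡a)) = inj₁ (q≡a , p≡b)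

  pair-sym : ∀ p q → pair p q ≡ pair q p
  pair-sym p q = does-⇔ (mk⇔ IsPair-swap IsPair-swap) (isPair? p q) (isPair? q p)

  pair-irrefl : a ≢ b → ∀ p → pair p p ≡ false
  pair-irrefl a≢b p = dec-false (isPair? p p) λ
    { (inj₁ (p≡a , p≡b)) → a≢b (trans (sym p≡a) p≡b)
    ; (inj₂ (p≡b , p≡a)) → a≢b (trans (sym p≡a) p≡b) }

module Quotient {n : ℕ} {_≈_ : Fin n → Fin n → Set} (isDecEquivalence : IsDecEquivalence _≈_) where

  open IsDecEquivalence isDecEquivalence renaming (refl to ≈-refl; sym to ≈-sym; trans to ≈-trans; _≟_ to _≈?_)

  abstract
    least : ∀ u → Σ (Fin n) λ a → u ≈ a × (∀ v → v F.< a → ¬ u ≈ v)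
    least u with FinP.¬∀⟶∃¬-smallest n (λ v → ¬ u ≈ v) (λ v → ¬? (u ≈? v)) (λ none → none u ≈-refl)
    ... | a , ¬¬u≈a , below with u ≈? a
    ... | yes u≈a = a , u≈a , λ v v<a u≈v → below (F.fromℕ< v<a) (subst (u ≈_) (sym (inject-fromℕ< v<a)) u≈v)
      where
        inject-fromℕ< : ∀ {v} (v<a : v F.< a) → F.inject (F.fromℕ< v<a) ≡ v
        inject-fromℕ< v<a = FinP.toℕ-injective (trans (FinP.toℕ-inject (F.fromℕ< v<a)) (FinP.toℕ-fromℕ< v<a))
    ... | no ¬u≈a = ⊥-elim (¬¬u≈a ¬u≈a)

    canon : Fin n → Fin n
    canon u = proj₁ (least u)

    ≈-canon : ∀ u → u ≈ canon u
    ≈-canon u = proj₁ (proj₂ (least u))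

    canon-cong : ∀ {u v} → u ≈ v → canon u ≡ canon v
    canon-cong {u} {v} u≈v with <-cmp (toℕ (canon u)) (toℕ (canon v))
    ... | tri< cu<cv _ _ = ⊥-elim (proj₂ (proj₂ (least v)) (canon u) cu<cv (≈-trans (≈-sym u≈v) (≈-canon u)))
    ... | tri≈ _ cu≡cv _ = FinP.toℕ-injective cu≡cv
    ... | tri> _ _ cv<cu = ⊥-elim (proj₂ (proj₂ (least u)) (canon v) cv<cu (≈-trans u≈v (≈-canon v)))

    canon-injective : ∀ {u v} → canon u ≡ canon v → u ≈ v
    canon-injective {u} {v} cu≡cv = ≈-trans (≈-canon u) (≈-sym (subst (v ≈_) (sym cu≡cv) (≈-canon v)))

    IsCanonical? : ∀ x → Dec (canon x ≡ x)
    IsCanonical? x = canon x FinP.≟ x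

    canonicals : List (Fin n)
    canonicals = filter IsCanonical? (allFin n)

    #classes : ℕ
    #classes = length canonicals

    canonicals-unique : Unique canonicals
    canonicals-unique = Unique.filter⁺ IsCanonical? (allFin⁺ n)

    canon∈canonicals : ∀ u → canon u ∈ₗ canonicals
    canon∈canonicals u = ∈-filter⁺ IsCanonical? (∈-allFin (canon u)) (sym (canon-cong (≈-canon u)))

    classOf : Fin n → Fin #classes
    classOf u = Any.index (canon∈canonicals u)

    representative : Fin #classes → Fin n
    representative = lookup canonicals

    representative-classOf : ∀ u → representative (classOf u) ≡ canon u
    representative-classOf u = sym (lookup-index (canon∈canonicals u))

    classOf-injective : ∀ {u v} → classOf u ≡ classOf v → u ≈ v
    classOf-injective {u} {v} same = canon-injective (begin
      canon u                         ≡⟨ representative-classOf u ⟨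
      representative (classOf u)      ≡⟨ cong representative same ⟩
      representative (classOf v)      ≡⟨ representative-classOf v ⟩
      canon v                         ∎)
      where open ≡-Reasoning

    classOf-cong : ∀ {u v} → u ≈ v → classOf u ≡ classOf v
    classOf-cong {u} {v} u≈v = lookup-injective canonicals-unique (classOf u) (classOf v)
      (trans (representative-classOf u) (trans (canon-cong u≈v) (sym (representative-classOf v))))

    classOf-representative : ∀ p → classOf (representative p) ≡ p
    classOf-representative p = lookup-injective canonicals-unique _ _
      (trans (representative-classOf (representative p))
             (proj₂ (∈-filter⁻ IsCanonical? {xs = allFin n} (∈-lookup p))))

xor-cancel : ∀ x m p z → (m xor p) xor (x xor (p xor z)) ≡ x xor (m xor z)
xor-cancel x m p z = begin
  (m xor p) xor (x xor (p xor z))   ≡⟨ cong ((m xor p) xor_) (⊕.x∙yz≈y∙xz x p z) ⟩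
  (m xor p) xor (p xor (x xor z))   ≡⟨ xor-assoc m p _ ⟩
  m xor (p xor (p xor (x xor z)))   ≡⟨ cong (m xor_) (xor-assoc p p (x xor z)) ⟨
  m xor ((p xor p) xor (x xor z))   ≡⟨ cong (λ b → m xor (b xor (x xor z))) (xor-same p) ⟩
  m xor (x xor z)                   ≡⟨ ⊕.x∙yz≈y∙xz m x z ⟩
  x xor (m xor z)                   ∎
  where open ≡-Reasoning

cyclicDist : ℕ → ℕ → ℕ → ℕ
cyclicDist ℓ a b = ∣ a - b ∣ ⊓ (ℓ ∸ ∣ a - b ∣)

module Paths (H : Graph) where

  infixr 5 _∷_ _++_

  data Path : V H → V H → Set where
    []  : ∀ {u} → Path u u
    _∷_ : ∀ {u w v} → Adj H u w → Path w v → Path u v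

  len : ∀ {u v} → Path u v → ℕ
  len [] = 0
  len (_ ∷ p) = suc (len p)

  _++_ : ∀ {u w v} → Path u w → Path w v → Path u v
  [] ++ q = q
  (e ∷ p) ++ q = e ∷ (p ++ q)

  len-++ : ∀ {u w v} (p : Path u w) (q : Path w v) → len (p ++ q) ≡ len p + len q
  len-++ [] q = refl
  len-++ (e ∷ p) q = cong suc (len-++ p q)

  reverse : ∀ {u v} → Path u v → Path v u
  reverse [] = []
  reverse (e ∷ p) = reverse p ++ (Graph.sym H e ∷ [])

  len-reverse : ∀ {u v} (p : Path u v) → len (reverse p) ≡ len p
  len-reverse [] = refl
  len-reverse (e ∷ p) = trans (len-++ (reverse p) _) (trans (+-comm (len (reverse p)) 1) (cong suc (len-reverse p)))

  cast : ∀ {u u' v v'} → u ≡ u' → v ≡ v' → Path u v → Path u' v'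
  cast refl refl p = p

  len-cast : ∀ {u u' v v'} (eu : u ≡ u') (ev : v ≡ v') (p : Path u v) → len (cast eu ev p) ≡ len p
  len-cast refl refl p = refl

  cast-++ : ∀ {u w w' v} (ew : w ≡ w') (p : Path u w) (q : Path w v) → cast refl ew p ++ cast ew refl q ≡ p ++ q
  cast-++ refl p q = refl

  -- Positions beyond the end of the path all denote its last vertex.
  vertex : ∀ {u v} → Path u v → ℕ → V H
  vertex {u} p zero = u
  vertex {u} [] (suc k) = u
  vertex (e ∷ p) (suc k) = vertex p k

  vertex-len : ∀ {u v} (p : Path u v) → vertex p (len p) ≡ v
  vertex-len [] = refl
  vertex-len (e ∷ p) = vertex-len p

  vertex-++ : ∀ {u w v} (p : Path u w) (q : Path w v) i → vertex (p ++ q) (len p + i) ≡ vertex q i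
  vertex-++ [] q i = refl
  vertex-++ (e ∷ p) q i = vertex-++ p q i

  vertex-step : ∀ {u v} (p : Path u v) k → k < len p → Adj H (vertex p k) (vertex p (suc k))
  vertex-step (e ∷ []) zero _ = e
  vertex-step (e ∷ _ ∷ _) zero _ = e
  vertex-step (e ∷ p) (suc k) (s≤s k<) = vertex-step p k k<

  walk : ∀ {u v} (p : Path u v) → Walk H u v (len p)
  walk [] = nil
  walk (e ∷ p) = cons e (walk p)

  path : ∀ {u v ℓ} → Walk H u v ℓ → Path u v
  path nil = []
  path (cons e w) = e ∷ path w

  len-path : ∀ {u v ℓ} (w : Walk H u v ℓ) → len (path w) ≡ ℓ
  len-path nil = refl
  len-path (cons e w) = cong suc (len-path w)

  walk? : ∀ m u v → Dec (Walk H u v m)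
  walk? zero u v with u FinP.≟ v
  ... | yes refl = yes nil
  ... | no u≢v = no λ { nil → u≢v refl }
  walk? (suc m) u v with FinP.any? (λ w → adj? H u w ×-dec walk? m w v)
  ... | yes (w , e , rest) = yes (cons e rest)
  ... | no none = no λ { (cons e rest) → none (_ , e , rest) }

  walk⇒dist : ∀ {u v ℓ} → Walk H u v ℓ → ∃ λ d → IsDist H u v d × d ≤ ℓ
  walk⇒dist {u} {v} {ℓ} = <-rec (λ ℓ → Walk H u v ℓ → ∃ λ d → IsDist H u v d × d ≤ ℓ) shortest ℓ
    where
      shortest : ∀ ℓ → (∀ {m} → m < ℓ → Walk H u v m → ∃ λ d → IsDist H u v d × d ≤ m) →
             Walk H u v ℓ → ∃ λ d → IsDist H u v d × d ≤ ℓ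
      shortest ℓ shorter w with anyUpTo? (λ m → walk? m u v) ℓ
      ... | yes (m , m<ℓ , w') = let (d , dist , d≤m) = shorter m<ℓ w' in d , dist , ≤-trans d≤m (<⇒≤ m<ℓ)
      ... | no none = ℓ , (w , λ m w' → ≮⇒≥ λ m<ℓ → none (m , m<ℓ , w')) , ≤-refl

  record Split {u v} (p : Path u v) (k : ℕ) : Set where
    field
      prefix : Path u (vertex p k)
      suffix : Path (vertex p k) v
      prefix-len : len prefix ≡ k
      prefix++suffix : prefix ++ suffix ≡ p

    suffix-len : len suffix ≡ len p ∸ k
    suffix-len = begin
      len suffix                          ≡⟨ m+n∸m≡n (len prefix) (len suffix) ⟨
      len prefix + len suffix ∸ len prefix ≡⟨ cong₂ _∸_ (trans (sym (len-++ prefix suffix)) (cong len prefix++suffix)) prefix-len ⟩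
      len p ∸ k                           ∎
      where open ≡-Reasoning

  splitAt : ∀ {u v} (p : Path u v) k → k ≤ len p → Split p k
  splitAt p zero _ = record { prefix = [] ; suffix = p ; prefix-len = refl ; prefix++suffix = refl }
  splitAt (e ∷ p) (suc k) (s≤s k≤) = record
    { prefix = e ∷ S.prefix ; suffix = S.suffix
    ; prefix-len = cong suc S.prefix-len ; prefix++suffix = cong (e ∷_) S.prefix++suffix }
    where module S = Split (splitAt p k k≤)

  record Split₃ {u v} (p : Path u v) (a b : ℕ) : Set where
    field
      left : Path u (vertex p a)
      middle : Path (vertex p a) (vertex p b)
      right : Path (vertex p b) v
      middle-len : len middle ≡ b ∸ a
      reassemble : left ++ middle ++ right ≡ p

    len-parts : len left + (len middle + len right) ≡ len p
    len-parts = begin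
      len left + (len middle + len right) ≡⟨ cong (len left +_) (len-++ middle right) ⟨
      len left + len (middle ++ right)    ≡⟨ len-++ left _ ⟨
      len (left ++ middle ++ right)       ≡⟨ cong len reassemble ⟩
      len p                               ∎
      where open ≡-Reasoning

    middle-≤ : len middle ≤ len p
    middle-≤ = subst (len middle ≤_) len-parts (≤-trans (m≤m+n (len middle) (len right)) (m≤n+m _ (len left)))

  split₃ : ∀ {u v} (p : Path u v) {a b} → a ≤ b → b ≤ len p → Split₃ p a b
  split₃ p {a} {b} a≤b b≤ = record
    { left = L.prefix ; middle = cast refl end R.prefix ; right = cast end refl R.suffix
    ; middle-len = trans (len-cast refl end R.prefix) R.prefix-len
    ; reassemble = trans (cong (L.prefix ++_) (trans (cast-++ end R.prefix R.suffix) R.prefix++suffix))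
                         L.prefix++suffix }
    where
      module L = Split (splitAt p a (≤-trans a≤b b≤))
      module R = Split (splitAt L.suffix (b ∸ a) (subst (b ∸ a ≤_) (sym L.suffix-len) (∸-monoˡ-≤ a b≤)))
      end : vertex L.suffix (b ∸ a) ≡ vertex p b
      end = begin
        vertex L.suffix (b ∸ a)                       ≡⟨ vertex-++ L.prefix L.suffix (b ∸ a) ⟨
        vertex (L.prefix ++ L.suffix) (len L.prefix + (b ∸ a)) ≡⟨ cong₂ vertex L.prefix++suffix (cong (_+ (b ∸ a)) L.prefix-len) ⟩
        vertex p (a + (b ∸ a))                        ≡⟨ cong (vertex p) (m+[n∸m]≡n a≤b) ⟩
        vertex p b                                    ∎
        where open ≡-Reasoning

  module Detour {u v} {p : Path u v} {a b} (S : Split₃ p a b) (same : vertex p a ≡ vertex p b) where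
    open Split₃ S

    bypass : Path u v
    bypass = left ++ cast (sym same) refl right

    loop : Path (vertex p a) (vertex p a)
    loop = cast refl (sym same) middle

    bypass-shorter : a < b → len bypass < len p
    bypass-shorter a<b = begin-strict
      len bypass                          ≡⟨ trans (len-++ left _) (cong (len left +_) (len-cast (sym same) refl right)) ⟩
      len left + len right                <⟨ +-monoʳ-< (len left) (m<n+m (len right) (subst (0 <_) (sym middle-len) (m<n⇒0<n∸m a<b))) ⟩
      len left + (len middle + len right) ≡⟨ len-parts ⟩
      len p                               ∎
      where open ≤-Reasoning

    loop-shorter : b < len p → len loop < len p
    loop-shorter b< = begin-strict
      len loop ≡⟨ trans (len-cast refl (sym same) middle) middle-len ⟩
      b ∸ a    ≤⟨ m∸n≤m b a ⟩
      b        <⟨ b< ⟩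
      len p    ∎
      where open ≤-Reasoning

  between : ∀ {u v} (p : Path u v) {i j} → i ≤ len p → j ≤ len p →
            Σ (Path (vertex p i) (vertex p j)) λ q → len q ≤ len p
  between p {i} {j} i≤ j≤ with i ≤? j
  ... | yes i≤j = middle , middle-≤
    where open Split₃ (split₃ p i≤j j≤)
  ... | no i≰j = reverse middle , subst (_≤ len p) (sym (len-reverse middle)) middle-≤
    where open Split₃ (split₃ p (<⇒≤ (≰⇒> i≰j)) i≤)

  short-walk : ∀ {u v} (p : Path u v) → ∃ λ m → m < size H × Walk H u v m
  short-walk p = <-rec Shortenable shorten (len p) p refl
    where
      Shortenable : ℕ → Set
      Shortenable n = ∀ {u v} (p : Path u v) → len p ≡ n → ∃ λ m → m < size H × Walk H u v m
      shorten : ∀ n → (∀ {n'} → n' < n → Shortenable n') → Shortenable n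
      shorten _ shorter p refl with len p <? size H
      ... | yes short = len p , short , walk p
      ... | no long with FinP.pigeonhole (≰⇒> long) (λ (k : Fin (suc (len p))) → vertex p (toℕ k))
      ... | i , j , i<j , same = shorter (bypass-shorter i<j) bypass refl
        where open Detour (split₃ p (<⇒≤ i<j) (≤-pred (FinP.toℕ<n j))) same

  reachable? : ∀ u v → Dec (Path u v)
  reachable? u v = map′ (λ (_ , _ , w) → path w) (λ p → short-walk p) (anyUpTo? (λ m → walk? m u v) (size H))

  record SimpleClosed {u} (W : Path u u) : Set where
    field
      pred-len : ℕ
      len≡ : len W ≡ suc pred-len
      long : 2 ≤ pred-len
      injective : ∀ (i j : Fin (suc pred-len)) → vertex W (toℕ i) ≡ vertex W (toℕ j) → i ≡ j

    position≤ : ∀ (i : Fin (suc pred-len)) → toℕ i ≤ len W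
    position≤ i = subst (toℕ i ≤_) (sym len≡) (<⇒≤ (FinP.toℕ<n i))

  toCycle : ∀ {u} {W : Path u u} → SimpleClosed W → Cycle H
  toCycle {W = W} s = record
    { L' = pred-len ; three = long ; f = λ i → vertex W (toℕ i)
    ; inj = λ {i} {j} → injective i j
    ; step = λ i → subst (λ k → Adj H (vertex W k) (vertex W (suc (toℕ i)))) (sym (FinP.toℕ-inject₁ i))
                         (vertex-step W (toℕ i) (subst (toℕ i <_) (sym len≡) (m<n⇒m<1+n (FinP.toℕ<n i))))
    ; close = subst₂ (Adj H) (cong (vertex W) (sym (FinP.toℕ-fromℕ pred-len)))
                             (trans (cong (vertex W) (sym len≡)) (vertex-len W))
                             (vertex-step W pred-len (subst (pred-len <_) (sym len≡) ≤-refl)) }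
    where open SimpleClosed s

  simple⊎repeat : ∀ {u w} (e : Adj H u w) (p : Path w u) → 2 ≤ len p →
    SimpleClosed (e ∷ p) ⊎ ∃₂ λ a b → a < b × b < len (e ∷ p) × vertex (e ∷ p) a ≡ vertex (e ∷ p) b
  simple⊎repeat e p 2≤ with injective⊎collision FinP._≟_ (λ (i : Fin (len (e ∷ p))) → vertex (e ∷ p) (toℕ i))
  ... | inj₁ injective = inj₁ record { pred-len = len p ; len≡ = refl ; long = 2≤ ; injective = injective }
  ... | inj₂ (i , j , i<j , same) = inj₂ (toℕ i , toℕ j , i<j , FinP.toℕ<n j , same)

  walkOf : ∀ {u v m} (p : Path u v) → len p ≡ m → Walk H u v m
  walkOf p refl = walk p

  walk-reverse : ∀ {u v m} → Walk H u v m → Walk H v u m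
  walk-reverse w = walkOf (reverse (path w)) (trans (len-reverse _) (len-path w))

  arc≤ : ∀ {u} (W : Path u u) {a b} → a ≤ b → b ≤ len W → Walk H (vertex W a) (vertex W b) (cyclicDist (len W) a b)
  arc≤ W {a} {b} a≤b b≤ rewrite m≤n⇒∣m-n∣≡n∸m a≤b with b ∸ a ≤? len W ∸ (b ∸ a)
  ... | yes inner≤outer = walkOf middle (trans middle-len (sym (m≤n⇒m⊓n≡m inner≤outer)))
    where open Split₃ (split₃ W a≤b b≤)
  ... | no inner≰outer = walkOf (reverse (right ++ left)) (begin
      len (reverse (right ++ left))
        ≡⟨ trans (len-reverse _) (len-++ right left) ⟩
      len right + len left
        ≡⟨ m+n∸n≡m _ (len middle) ⟨
      len right + len left + len middle ∸ len middle
        ≡⟨ cong₂ _∸_ (trans (sym (+ℕ.x∙yz≈zx∙y (len left) (len middle) (len right))) len-parts) middle-len ⟩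
      len W ∸ (b ∸ a)
        ≡⟨ m≥n⇒m⊓n≡n (<⇒≤ (≰⇒> inner≰outer)) ⟨
      (b ∸ a) ⊓ (len W ∸ (b ∸ a)) ∎)
    where
      open Split₃ (split₃ W a≤b b≤)
      open ≡-Reasoning

  arc : ∀ {u} (W : Path u u) {a b} → a ≤ len W → b ≤ len W → Walk H (vertex W a) (vertex W b) (cyclicDist (len W) a b)
  arc W {a} {b} a≤ b≤ with a ≤? b
  ... | yes a≤b = arc≤ W a≤b b≤
  ... | no a≰b = walk-reverse (subst (Walk H _ _) (cong (λ d → d ⊓ (len W ∸ d)) (∣-∣-comm b a)) (arc≤ W (<⇒≤ (≰⇒> a≰b)) a≤))

  along : ∀ n (h : Fin (suc n) → V H) → (∀ i → Adj H (h (inject₁ i)) (h (F.suc i))) → Path (h F.zero) (h (fromℕ n))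
  along zero h steps = []
  along (suc n) h steps = steps F.zero ∷ along n (h ∘ F.suc) (steps ∘ F.suc)

  cycleWalk : (C : Cycle H) → Path (f C F.zero) (f C F.zero)
  cycleWalk C = along (L' C) (f C) (step C) ++ (close C ∷ [])

  Shortcut : Cycle H → Set
  Shortcut C = ∃₂ λ i j → ∃ λ m → m < cycDist C i j × Walk H (f C i) (f C j) m

  shortcut? : ∀ C → Dec (Shortcut C)
  shortcut? C = FinP.any? λ i → FinP.any? λ j → anyUpTo? (λ m → walk? m (f C i) (f C j)) (cycDist C i j)

  geodesic-without-shortcut : ∀ C → (∀ i j → Walk H (f C i) (f C j) (cycDist C i j)) → ¬ Shortcut C → Geodesic C
  geodesic-without-shortcut C arcs none i j = arcs i j , λ m w → ≮⇒≥ λ m< → none (i , j , m , m< , w)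

  module Parity (g : V H → V H → Bool) where

    parity : ∀ {u v} → Path u v → Bool
    parity [] = false
    parity (_∷_ {u} {w} _ p) = g u w xor parity p

    parity-++ : ∀ {u w v} (p : Path u w) (q : Path w v) → parity (p ++ q) ≡ parity p xor parity q
    parity-++ [] q = refl
    parity-++ (_∷_ {u} {w} e p) q = trans (cong (g u w xor_) (parity-++ p q)) (sym (xor-assoc (g u w) (parity p) (parity q)))

    parity-cast : ∀ {u u' v v'} (eu : u ≡ u') (ev : v ≡ v') (p : Path u v) → parity (cast eu ev p) ≡ parity p
    parity-cast refl refl p = refl

    parity-split₃ : ∀ {u v} {p : Path u v} {a b} (S : Split₃ p a b) →
      let open Split₃ S in parity p ≡ parity left xor (parity middle xor parity right)
    parity-split₃ {p = p} S = begin
      parity p                                        ≡⟨ cong parity reassemble ⟨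
      parity (left ++ middle ++ right)                ≡⟨ parity-++ left _ ⟩
      parity left xor parity (middle ++ right)        ≡⟨ cong (parity left xor_) (parity-++ middle right) ⟩
      parity left xor (parity middle xor parity right) ∎
      where
        open Split₃ S
        open ≡-Reasoning

    parity-along : ∀ n (h : Fin (suc n) → V H) (steps : ∀ i → Adj H (h (inject₁ i)) (h (F.suc i))) →
      (∀ i → g (h (inject₁ i)) (h (F.suc i)) ≡ false) → parity (along n h steps) ≡ false
    parity-along zero h steps unlabelled = refl
    parity-along (suc n) h steps unlabelled =
      cong₂ _xor_ (unlabelled F.zero) (parity-along n (h ∘ F.suc) (steps ∘ F.suc) (unlabelled ∘ F.suc))

    parity-unlabelled : ∀ {In : V H → Set} → (∀ {u w} → In u → In w → g u w ≡ false) →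
      ∀ {u v} (p : Path u v) → (∀ k → k ≤ len p → In (vertex p k)) → parity p ≡ false
    parity-unlabelled unlabelled [] _ = refl
    parity-unlabelled unlabelled (e ∷ p) inside =
      cong₂ _xor_ (unlabelled (inside 0 z≤n) (inside 1 (s≤s z≤n))) (parity-unlabelled unlabelled p (λ k k≤ → inside (suc k) (s≤s k≤)))

    module Symmetric (g-sym : ∀ u v → g u v ≡ g v u) where

      parity-reverse : ∀ {u v} (p : Path u v) → parity (reverse p) ≡ parity p
      parity-reverse [] = refl
      parity-reverse (_∷_ {u} {w} e p) = begin
        parity (reverse p ++ (Graph.sym H e ∷ [])) ≡⟨ parity-++ (reverse p) _ ⟩
        parity (reverse p) xor (g w u xor false)   ≡⟨ cong₂ _xor_ (parity-reverse p) (trans (xor-identityʳ _) (g-sym w u)) ⟩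
        parity p xor g u w                         ≡⟨ xor-comm (parity p) _ ⟩
        g u w xor parity p                         ∎
        where open ≡-Reasoning

      Vanishes : ℕ → Set
      Vanishes n = ∀ {v} (W : Path v v) → len W < n → parity W ≡ false

      parity-detour : ∀ {u} {W : Path u u} {a b} (S : Split₃ W a b) (same : vertex W a ≡ vertex W b) →
        a < b → b < len W → Vanishes (len W) → parity W ≡ false
      parity-detour {W = W} S same a<b b< smaller = begin
        parity W
          ≡⟨ parity-split₃ S ⟩
        parity left xor (parity middle xor parity right)
          ≡⟨ ⊕.x∙yz≈xz∙y (parity left) _ _ ⟩
        (parity left xor parity right) xor parity middle
          ≡⟨ cong₂ _xor_ (cong (parity left xor_) (parity-cast (sym same) refl right)) (parity-cast refl (sym same) middle) ⟨
        (parity left xor parity (cast (sym same) refl right)) xor parity loop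
          ≡⟨ cong (_xor parity loop) (parity-++ left _) ⟨
        parity bypass xor parity loop
          ≡⟨ cong₂ _xor_ (smaller bypass (bypass-shorter a<b)) (smaller loop (loop-shorter b<)) ⟩
        false ∎
        where
          open Split₃ S
          open Detour S same
          open ≡-Reasoning

      -- P splits W into the shorter closed walks middle ++ reverse P and left ++ P ++ right, and parity P cancels.
      parity-shortcut≤ : ∀ {u} (W : Path u u) {a b} → a ≤ b → b ≤ len W → (P : Path (vertex W a) (vertex W b)) →
        len P < (b ∸ a) ⊓ (len W ∸ (b ∸ a)) → Vanishes (len W) → parity W ≡ false
      parity-shortcut≤ W {a} {b} a≤b b≤ P P< smaller = let open ≡-Reasoning in begin
        parity W                                               ≡⟨ parity-split₃ S ⟩
        parity left xor (parity middle xor parity right)       ≡⟨ xor-cancel (parity left) (parity middle) (parity P) (parity right) ⟨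
        (parity middle xor parity P) xor (parity left xor (parity P xor parity right))
          ≡⟨ cong₂ _xor_ (trans (cong (parity middle xor_) (sym (parity-reverse P))) (sym (parity-++ middle _)))
                         (trans (cong (parity left xor_) (sym (parity-++ P right))) (sym (parity-++ left _))) ⟩
        parity (middle ++ reverse P) xor parity (left ++ P ++ right) ≡⟨ cong₂ _xor_ (smaller _ around-P) (smaller _ through-P) ⟩
        false                                                  ∎
        where
          S = split₃ W a≤b b≤
          open Split₃ S
          around-P : len (middle ++ reverse P) < len W
          around-P = begin-strict
            len (middle ++ reverse P) ≡⟨ trans (len-++ middle _) (cong₂ _+_ middle-len (len-reverse P)) ⟩
            b ∸ a + len P             <⟨ +-monoʳ-< (b ∸ a) (m<n⊓o⇒m<o _ _ P<) ⟩
            b ∸ a + (len W ∸ (b ∸ a)) ≡⟨ m+[n∸m]≡n (≤-trans (m∸n≤m b a) b≤) ⟩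
            len W                     ∎
            where open ≤-Reasoning
          through-P : len (left ++ P ++ right) < len W
          through-P = begin-strict
            len (left ++ P ++ right)            ≡⟨ trans (len-++ left _) (cong (len left +_) (len-++ P right)) ⟩
            len left + (len P + len right)      <⟨ +-monoʳ-< (len left) (+-monoˡ-< (len right) P<middle) ⟩
            len left + (len middle + len right) ≡⟨ len-parts ⟩
            len W                               ∎
            where
              open ≤-Reasoning
              P<middle = subst (len P <_) (sym middle-len) (m<n⊓o⇒m<n _ _ P<)

      parity-shortcut : ∀ {u} (W : Path u u) {a b} → a ≤ len W → b ≤ len W → (P : Path (vertex W a) (vertex W b)) →
        len P < cyclicDist (len W) a b → Vanishes (len W) → parity W ≡ false
      parity-shortcut W {a} {b} a≤ b≤ P P< with a ≤? b
      ... | yes a≤b = parity-shortcut≤ W a≤b b≤ P (subst (λ d → len P < d ⊓ (len W ∸ d)) (m≤n⇒∣m-n∣≡n∸m a≤b) P<)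
      ... | no a≰b = parity-shortcut≤ W b≤a a≤ (reverse P)
        (subst₂ _<_ (sym (len-reverse P)) (cong (λ d → d ⊓ (len W ∸ d)) (trans (∣-∣-comm a b) (m≤n⇒∣m-n∣≡n∸m b≤a))) P<)
        where b≤a = <⇒≤ (≰⇒> a≰b)

      -- A closed walk that is not a cycle splits at a repeated vertex into two shorter closed walks.
      closed-walk-induction : (∀ {u} {W : Path u u} → SimpleClosed W → Vanishes (len W) → parity W ≡ false) →
        ∀ {u} (W : Path u u) → parity W ≡ false
      closed-walk-induction simple W = vanishes (suc (len W)) W ≤-refl
        where
          closed : ∀ {u} (W : Path u u) → Vanishes (len W) → parity W ≡ false
          closed [] _ = refl
          closed (e ∷ []) _ = ⊥-elim (irrefl H e)
          closed (_∷_ {u} {w} e (_ ∷ [])) _ =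
            trans (cong (g u w xor_) (trans (xor-identityʳ _) (g-sym w u))) (xor-same (g u w))
          closed W@(e ∷ p@(_ ∷ _ ∷ _)) smaller with simple⊎repeat e p (s≤s (s≤s z≤n))
          ... | inj₁ s = simple s smaller
          ... | inj₂ (a , b , a<b , b< , same) = parity-detour (split₃ W (<⇒≤ a<b) (<⇒≤ b<)) same a<b b< smaller
          vanishes : ∀ n → Vanishes n
          vanishes zero W ()
          vanishes (suc n) W (s≤s len≤n) = closed W (λ W' W'< → vanishes n W' (≤-trans W'< len≤n))

      parity-closed-walk-acyclic : ¬ Cycle H → ∀ {u} (W : Path u u) → parity W ≡ false
      parity-closed-walk-acyclic acyclic = closed-walk-induction λ s _ → ⊥-elim (acyclic (toCycle s))

      parity-closed-walk : ∀ c → GeodesicCyclesAtMost H c → (∀ {u} (W : Path u u) → len W ≤ c → parity W ≡ false) →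
        ∀ {u} (W : Path u u) → parity W ≡ false
      parity-closed-walk c geodesic≤c short = closed-walk-induction simple
        where
          simple : ∀ {u} {W : Path u u} → SimpleClosed W → Vanishes (len W) → parity W ≡ false
          simple {W = W} s smaller with len W ≤? c | shortcut? (toCycle s)
          ... | yes W≤c | _ = short W W≤c
          ... | no W≰c | yes (i , j , m , m< , w) =
            parity-shortcut W (position≤ i) (position≤ j) (path w)
              (subst₂ _<_ (sym (len-path w)) (cong (λ ℓ → cyclicDist ℓ (toℕ i) (toℕ j)) (sym len≡)) m<) smaller
            where open SimpleClosed s
          ... | no W≰c | no none = ⊥-elim (W≰c (subst (_≤ c) (sym len≡) (geodesic≤c (toCycle s) geodesic)))
            where
              open SimpleClosed s
              geodesic : Geodesic (toCycle s)
              geodesic = geodesic-without-shortcut (toCycle s) arcs none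
                where
                  arcs : ∀ i j → Walk H (vertex W (toℕ i)) (vertex W (toℕ j)) (cyclicDist (suc pred-len) (toℕ i) (toℕ j))
                  arcs i j = subst (Walk H _ _) (cong (λ ℓ → cyclicDist ℓ (toℕ i) (toℕ j)) len≡) (arc W (position≤ i) (position≤ j))

  closing-edge-parity : (C : Cycle H) → Parity.parity (Pair.pair (f C (fromℕ (L' C))) (f C F.zero)) (cycleWalk C) ≡ true
  closing-edge-parity C = begin
    parity (along (L' C) (f C) (step C) ++ (close C ∷ []))
      ≡⟨ parity-++ (along (L' C) (f C) (step C)) _ ⟩
    parity (along (L' C) (f C) (step C)) xor (pair (f C (fromℕ (L' C))) (f C F.zero) xor false)
      ≡⟨ cong₂ _xor_ (parity-along _ (f C) (step C) inner-unlabelled) (trans (xor-identityʳ _) (pair-true (inj₁ (refl , refl)))) ⟩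
    true ∎
    where
      open Pair (f C (fromℕ (L' C))) (f C F.zero)
      open Parity pair
      open ≡-Reasoning
      inner-unlabelled : ∀ i → pair (f C (inject₁ i)) (f C (F.suc i)) ≡ false
      inner-unlabelled i = ¬-not λ labelled → case pair-true⁻¹ labelled of λ
        { (inj₁ (first≡last , _)) → <⇒≢ (FinP.toℕ<n i)
            (trans (sym (FinP.toℕ-inject₁ i)) (trans (cong toℕ (inj C first≡last)) (FinP.toℕ-fromℕ (L' C))))
        ; (inj₂ (first≡0 , second≡last)) →
            let i≡0 = trans (sym (FinP.toℕ-inject₁ i)) (cong toℕ (inj C first≡0))
                1+i≡L' = trans (cong toℕ (inj C second≡last)) (FinP.toℕ-fromℕ (L' C))
            in case subst (2 ≤_) (trans (sym 1+i≡L') (cong suc i≡0)) (three C) of λ { (s≤s ()) } }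

  exit-edge : ∀ {P : V H → Set} → (∀ v → Dec (P v)) → ∀ {u v} → Path u v → P u → ¬ P v →
    ∃₂ λ a b → Path u a × P a × ¬ P b × Adj H a b
  exit-edge P? [] Pu ¬Pv = ⊥-elim (¬Pv Pu)
  exit-edge P? (_∷_ {w = w} e p) Pu ¬Pv with P? w
  ... | no ¬Pw = _ , w , [] , Pu , ¬Pw , e
  ... | yes Pw = let (a , b , q , Pa , ¬Pb , e') = exit-edge P? p Pw ¬Pv in a , b , e ∷ q , Pa , ¬Pb , e'

module Refinement (G : Graph) (c : ℕ) (D : StrongTreeDecomp G) where

  open Paths G
  module PT = Paths (T D)

  bag : V G → V (T D)
  bag = β D

  Near : V G → V G → Set
  Near u v = Σ (Path u v) λ p → len p ≤ c

  near? : ∀ u v → Dec (Near u v)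
  near? u v = map′ (λ (_ , m≤c , w) → path w , subst (_≤ c) (sym (len-path w)) (≤-pred m≤c))
                   (λ (p , p≤c) → len p , s≤s p≤c , walk p)
                   (anyUpTo? (λ m → walk? m u v) (suc c))

  near-sym : ∀ {u v} → Near u v → Near v u
  near-sym (p , p≤c) = reverse p , subst (_≤ c) (sym (len-reverse p)) p≤c

  Linked : Graph
  Linked = record
    { size = size G
    ; Adj = λ u v → u ≢ v × bag u ≡ bag v × Near u v
    ; adj? = λ u v → ¬? (u FinP.≟ v) ×-dec ((bag u FinP.≟ bag v) ×-dec near? u v)
    ; sym = λ (u≢v , same , near) → u≢v ∘ sym , sym same , near-sym near
    ; irrefl = λ (u≢u , _) → u≢u refl }

  module PL = Paths Linked

  infix 4 _∼_
  _∼_ : V G → V G → Set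
  _∼_ = PL.Path

  ∼-bag : ∀ {u v} → u ∼ v → bag u ≡ bag v
  ∼-bag PL.[] = refl
  ∼-bag ((_ , same , _) PL.∷ p) = trans same (∼-bag p)

  near⇒∼ : ∀ {u v} → Near u v → bag u ≡ bag v → u ∼ v
  near⇒∼ {u} {v} near same with u FinP.≟ v
  ... | yes refl = PL.[]
  ... | no u≢v = (u≢v , same , near) PL.∷ PL.[]

  ∼-isDecEquivalence : IsDecEquivalence _∼_
  ∼-isDecEquivalence = record
    { isEquivalence = record { refl = PL.[] ; sym = PL.reverse ; trans = PL._++_ }
    ; _≟_ = PL.reachable? }

  open Quotient ∼-isDecEquivalence

  home : Fin #classes → V (T D)
  home p = bag (representative p)

  at-home : ∀ {z p} → classOf z ≡ p → bag z ≡ home p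
  at-home {z} refl = ∼-bag (classOf-injective (sym (classOf-representative (classOf z))))

  T′ : Graph
  T′ = record
    { size = #classes
    ; Adj = λ p q → p ≢ q × ∃₂ λ u v → classOf u ≡ p × classOf v ≡ q × Adj G u v
    ; adj? = λ p q → ¬? (p FinP.≟ q) ×-dec
        FinP.any? (λ u → FinP.any? (λ v → (classOf u FinP.≟ p) ×-dec ((classOf v FinP.≟ q) ×-dec adj? G u v)))
    ; sym = λ (p≢q , u , v , u∈p , v∈q , e) → p≢q ∘ sym , v , u , v∈q , u∈p , Graph.sym G e
    ; irrefl = λ (p≢p , _) → p≢p refl }

  module P′ = Paths T′

  T′-edges : ∀ {u v} → Adj G u v → classOf u ≡ classOf v ⊎ Adj T′ (classOf u) (classOf v)
  T′-edges {u} {v} e with classOf u FinP.≟ classOf v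
  ... | yes same = inj₁ same
  ... | no differ = inj₂ (differ , u , v , refl , refl , e)

  toT′ : ∀ {u v} → Path u v → P′.Path (classOf u) (classOf v)
  toT′ [] = P′.[]
  toT′ (e ∷ p) with T′-edges e
  ... | inj₁ same = P′.cast (sym same) refl (toT′ p)
  ... | inj₂ e′ = e′ P′.∷ toT′ p

  T′-connected : Connected G → Connected T′
  T′-connected (v₀ , walks) = classOf v₀ , λ p q →
    let (_ , w) = walks (representative p) (representative q)
        π = P′.cast (classOf-representative p) (classOf-representative q) (toT′ (path w))
    in P′.len π , P′.walk π

  project : ∀ {u v} → Path u v → PT.Path (bag u) (bag v)
  project [] = PT.[]
  project (e ∷ p) with edges D e
  ... | inj₁ same = PT.cast (sym same) refl (project p)
  ... | inj₂ e′ = e′ PT.∷ project p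

  parity-project : ∀ (g : V G → V G → Bool) (h : V (T D) → V (T D) → Bool) {In : V G → Set} →
    (∀ {u w} → In u → In w → bag u ≡ bag w → g u w ≡ false) →
    (∀ {u w} → In u → In w → g u w ≡ h (bag u) (bag w)) →
    ∀ {u v} (p : Path u v) → (∀ k → k ≤ len p → In (vertex p k)) →
    Parity.parity g p ≡ PT.Parity.parity h (project p)
  parity-project g h stutter cross [] inside = refl
  parity-project g h stutter cross (e ∷ p) inside with edges D e
  ... | inj₁ same = trans (cong₂ _xor_ (stutter (inside 0 z≤n) (inside 1 (s≤s z≤n)) same) rest)
                          (sym (PT.Parity.parity-cast h (sym same) refl (project p)))
    where rest = parity-project g h stutter cross p (λ k k≤ → inside (suc k) (s≤s k≤))
  ... | inj₂ e′ = cong₂ _xor_ (cross (inside 0 z≤n) (inside 1 (s≤s z≤n)))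
                              (parity-project g h stutter cross p (λ k k≤ → inside (suc k) (s≤s k≤)))

  module Crossings (p₀ p₁ : Fin #classes) (p₀≢p₁ : p₀ ≢ p₁) where

    open Pair p₀ p₁
    module Home = Pair (home p₀) (home p₁)

    crossing : V G → V G → Bool
    crossing u v = pair (classOf u) (classOf v)

    crossing-sym : ∀ u v → crossing u v ≡ crossing v u
    crossing-sym u v = pair-sym (classOf u) (classOf v)

    open Parity crossing

    -- Along a walk of length at most c, vertices in a common bag lie in a common class;
    -- so once both classes occur on it, crossings are read off in the tree.
    module ShortWalk {x y} (P : Path x y) (P≤c : len P ≤ c) where

      OnP : V G → Set
      OnP z = ∃ λ k → k ≤ len P × vertex P k ≡ z

      on-P : ∀ k → k ≤ len P → OnP (vertex P k)
      on-P k k≤ = k , k≤ , refl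

      same-bag⇒same-class : ∀ {u w} → OnP u → OnP w → bag u ≡ bag w → classOf u ≡ classOf w
      same-bag⇒same-class (i , i≤ , refl) (j , j≤ , refl) same =
        let (q , q≤) = between P i≤ j≤ in classOf-cong (near⇒∼ (q , ≤-trans q≤ P≤c) same)

      Occurs : Fin #classes → Set
      Occurs p = ∃ λ z → OnP z × classOf z ≡ p

      occurs? : ∀ p → Dec (Occurs p)
      occurs? p = map′ (λ (k , k∈p) → _ , on-P (toℕ k) (≤-pred (FinP.toℕ<n k)) , k∈p)
                       (λ { (_ , (k , k≤ , refl) , z∈p) → F.fromℕ< (s≤s k≤) ,
                          subst (λ i → classOf (vertex P i) ≡ p) (sym (FinP.toℕ-fromℕ< (s≤s k≤))) z∈p })
                       (FinP.any? λ (k : Fin (suc (len P))) → classOf (vertex P (toℕ k)) FinP.≟ p)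

      crossing⇒occurs : ∀ {u w} → OnP u → OnP w → crossing u w ≡ true → Occurs p₀ × Occurs p₁
      crossing⇒occurs onU onW crosses with pair-true⁻¹ crosses
      ... | inj₁ (u∈p₀ , w∈p₁) = (_ , onU , u∈p₀) , (_ , onW , w∈p₁)
      ... | inj₂ (u∈p₁ , w∈p₀) = (_ , onW , w∈p₀) , (_ , onU , u∈p₁)

      class-from-bag : ∀ {u p} → Occurs p → OnP u → bag u ≡ home p → classOf u ≡ p
      class-from-bag (z , onZ , z∈p) onU at-p = trans (same-bag⇒same-class onU onZ (trans at-p (sym (at-home z∈p)))) z∈p

      module _ (occurs₀ : Occurs p₀) (occurs₁ : Occurs p₁) where

        crossing≡home-crossing : ∀ {u w} → OnP u → OnP w → crossing u w ≡ Home.pair (bag u) (bag w)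
        crossing≡home-crossing {u} {w} onU onW = does-⇔ (mk⇔ to from) (isPair? _ _) (Home.isPair? _ _)
          where
            to : IsPair (classOf u) (classOf w) → Home.IsPair (bag u) (bag w)
            to (inj₁ (u∈p₀ , w∈p₁)) = inj₁ (at-home u∈p₀ , at-home w∈p₁)
            to (inj₂ (u∈p₁ , w∈p₀)) = inj₂ (at-home u∈p₁ , at-home w∈p₀)
            from : Home.IsPair (bag u) (bag w) → IsPair (classOf u) (classOf w)
            from (inj₁ (u∈p₀ , w∈p₁)) = inj₁ (class-from-bag occurs₀ onU u∈p₀ , class-from-bag occurs₁ onW w∈p₁)
            from (inj₂ (u∈p₁ , w∈p₀)) = inj₂ (class-from-bag occurs₁ onU u∈p₁ , class-from-bag occurs₀ onW w∈p₀)

      short-parity : bag x ≡ bag y → parity P ≡ false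
      short-parity same with occurs? p₀ ×-dec occurs? p₁
      ... | yes (occurs₀ , occurs₁) = begin
        parity P
          ≡⟨ parity-project crossing Home.pair stutter (crossing≡home-crossing occurs₀ occurs₁) P on-P ⟩
        Tree.parity (project P)
          ≡⟨ Tree.parity-cast refl (sym same) (project P) ⟨
        Tree.parity (PT.cast refl (sym same) (project P))
          ≡⟨ parity-closed-walk-acyclic (proj₂ (tree D)) (PT.cast refl (sym same) (project P)) ⟩
        false ∎
        where
          open ≡-Reasoning
          module Tree = PT.Parity Home.pair
          open Tree.Symmetric Home.pair-sym using (parity-closed-walk-acyclic)
          stutter : ∀ {u w} → OnP u → OnP w → bag u ≡ bag w → crossing u w ≡ false
          stutter {u} onU onW same =
            trans (cong (pair (classOf u)) (sym (same-bag⇒same-class onU onW same))) (pair-irrefl p₀≢p₁ (classOf u))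
      ... | no ¬both = parity-unlabelled (λ onU onW → ¬-not (¬both ∘ crossing⇒occurs onU onW)) P on-P

    open ShortWalk using (short-parity)

    ∼-parity : ∀ {x y} → x ∼ y → Σ (Path x y) λ P → parity P ≡ false
    ∼-parity PL.[] = [] , refl
    ∼-parity ((_ , same , (q , q≤c)) PL.∷ rest) =
      let (P , P-parity) = ∼-parity rest
      in q ++ P , trans (parity-++ q P) (cong₂ _xor_ (short-parity q q≤c same) P-parity)

    lift : ∀ {p q} (π : P′.Path p q) {x y} → classOf x ≡ p → classOf y ≡ q →
      Σ (Path x y) λ P → parity P ≡ P′.Parity.parity pair π
    lift P′.[] x∈p y∈p = ∼-parity (classOf-injective (trans x∈p (sym y∈p)))
    lift ((_ , a , b , a∈p , b∈p′ , e) P′.∷ π) x∈p y∈q =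
      let (P₁ , P₁-parity) = ∼-parity (classOf-injective (trans x∈p (sym a∈p)))
          (P₂ , P₂-parity) = lift π b∈p′ y∈q
      in P₁ ++ e ∷ P₂ , trans (parity-++ P₁ (e ∷ P₂)) (cong₂ _xor_ P₁-parity (cong₂ _xor_ (cong₂ pair a∈p b∈p′) P₂-parity))

  T′-acyclic : GeodesicCyclesAtMost G c → ¬ Cycle T′
  T′-acyclic geodesic≤c C = case (begin
      true                                   ≡⟨ P′.closing-edge-parity C ⟨
      P′.Parity.parity pair (P′.cycleWalk C) ≡⟨ proj₂ lifted ⟨
      parity (proj₁ lifted)                  ≡⟨ parity-closed-walk c geodesic≤c short (proj₁ lifted) ⟩
      false                                  ∎) of λ ()
    where
      p₀ = f C (fromℕ (L' C))
      p₁ = f C F.zero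
      p₀≢p₁ : p₀ ≢ p₁
      p₀≢p₁ same = case subst (2 ≤_) (trans (sym (FinP.toℕ-fromℕ (L' C))) (cong toℕ (inj C same))) (three C) of λ ()
      open Pair p₀ p₁ using (pair)
      open Crossings p₀ p₁ p₀≢p₁
      open Parity crossing
      open Symmetric crossing-sym
      open ≡-Reasoning
      lifted = lift (P′.cycleWalk C) (classOf-representative p₁) (classOf-representative p₁)
      short : ∀ {u} (W : Path u u) → len W ≤ c → parity W ≡ false
      short W W≤c = ShortWalk.short-parity W W≤c refl

  refined : Connected G → GeodesicCyclesAtMost G c → StrongTreeDecomp G
  refined connected geodesic≤c = record
    { T = T′ ; tree = T′-connected connected , T′-acyclic geodesic≤c ; β = classOf
    ; nonempty = λ p → representative p , classOf-representative p ; edges = T′-edges }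

  refined-width : ∀ connected geodesic≤c {k} → WidthAtMost D k → WidthAtMost (refined connected geodesic≤c) k
  refined-width _ _ width≤k p = ≤-trans
    (length-filter-mono (λ v → classOf v FinP.≟ p) (λ v → bag v FinP.≟ home p) (λ v → at-home) (allFin (size G)))
    (width≤k (home p))

  refined-property : ∀ connected geodesic≤c → Property (refined connected geodesic≤c) c
  refined-property _ _ p S S⊆p (s , s∈S) (w , w∈p , w∉S)
    with PL.exit-edge (λ v → v ∈? S) (classOf-injective (trans (S⊆p s s∈S) (sym w∈p))) s∈S w∉S
  ... | a , b , s∼a , a∈S , b∉S , edge@(_ , _ , near) =
    b , trans (sym (classOf-cong (s∼a PL.++ edge PL.∷ PL.[]))) (S⊆p s s∈S) , b∉S , a , a∈S , distance (near-sym near)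
    where
      distance : ∀ {u v} → Near u v → DistAtMost G u v c
      distance (q , q≤c) = let (d , dist , d≤) = walk⇒dist (walk q) in d , dist , ≤-trans d≤ q≤c

lemma9 : (G : Graph) (k c : ℕ) →
    Connected G → StwAtMost G k → GeodesicCyclesAtMost G c →
    Σ (StrongTreeDecomp G) λ D → WidthAtMost D k × Property D c
lemma9 G k c connected (D , width≤k) geodesic≤c =
  refined connected geodesic≤c , refined-width connected geodesic≤c width≤k , refined-property connected geodesic≤c
  where open Refinement G c D
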